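{- The subgroup $U$ is topologically generated by $\gamma_1:=a_2a_3^{ -1}$ and $\gamma_2:=a_3^{ -1}a_2$.
   Context: Let $T$ be the infinite regular rooted binary tree (vertices: finite words over $\{1,2\}$) and $\Omega=\mathrm{Aut}(T)$ with the profinite topology. Write elements of $\Omega$ as $(u,v)\tau$ with $u,v\in\Omega$ (actions on the two subtrees at level 1) and $\tau\in\{\mathrm{id},\sigma\}$, $\sigma=(\mathrm{id},\mathrm{id})\sigma$ the swap; multiplication: $(x_1,x_2)\tau(y_1,y_2)\tau'=(x_1y_{\tau(1)},x_2y_{\tau(2)})\tau\tau'$. Let $a_1,a_2,a_3\in\Omega$ be the unique elements with $a_1=\sigma$, $a_2=(a_3^{ -1},a_2^{ -1})\sigma$, $a_3=(a_2,a_3)$. Let $G$ be the closed subgroup topologically generated by $a_1,a_2,a_3$, and let $U$ be the closed normal subgroup of $G$ generated by $a_2a_3^{ -1}$. -}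

module Defs where

open import Data.Bool using (Bool; true; false; _xor_)
open import Data.List using (List; []; _∷_; length)
open import Data.List.Relation.Unary.All using (All)
open import Data.Nat using (ℕ; _<_)
open import Data.Product using (Σ; _×_)
open import Data.Sum using (_⊎_)
open import Relation.Binary.PropositionalEquality using (_≡_)

-- Vertices of the binary rooted tree: finite words over {1,2},
-- encoded with letter 1 = false, letter 2 = true.
Word : Set
Word = List Bool

-- An automorphism of T is given by its portrait: at each vertex, whether it
-- swaps the two children (true = σ, false = id).
Ω : Set
Ω = Word → Bool

_≈_ : Ω → Ω → Set
g ≈ h = ∀ w → g w ≡ h w
infix 4 _≈_

-- (u , v) τ  with τ = σ iff t = true.
node : Bool → Ω → Ω → Ω
node t u v []          = t
node t u v (false ∷ w) = u w
node t u v (true ∷ w)  = v w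

-- section of g at the child i (the component g_i in g = (g_1,g_2)τ)
sec : Ω → Bool → Ω
sec g i w = g (i ∷ w)

e : Ω
e _ = false

σ : Ω
σ = node true e e

-- (x1,x2)τ (y1,y2)τ' = (x1 y_{τ(1)}, x2 y_{τ(2)}) ττ'
_·_ : Ω → Ω → Ω
(g · h) []      = g [] xor h []
(g · h) (i ∷ w) = (sec g i · sec h (i xor g [])) w
infixl 7 _·_

-- inverse: ((x1,x2)τ)⁻¹ = (x_{τ(1)}⁻¹ , x_{τ(2)}⁻¹) τ
inv : Ω → Ω
inv g []      = g []
inv g (i ∷ w) = inv (sec g (i xor g [])) w

-- g and h agree on all vertices of level < n (basic neighbourhoods of the
-- profinite topology)
Agree : ℕ → Ω → Ω → Set
Agree n g h = ∀ w → length w < n → g w ≡ h w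

IsClosed : (Ω → Set) → Set
IsClosed S = ∀ g → (∀ n → Σ Ω (λ h → S h × Agree n g h)) → S g

IsSubgroup : (Ω → Set) → Set
IsSubgroup S = S e × (∀ g h → S g → S h → S (g · h)) × (∀ g → S g → S (inv g))

IsClosedSubgroup : (Ω → Set) → Set
IsClosedSubgroup S = IsSubgroup S × IsClosed S

ClosedGen : List Ω → Ω → Set₁
ClosedGen gens g = ∀ (S : Ω → Set) → IsClosedSubgroup S → All S gens → S g

ClosedNormalGen : (Ω → Set₁) → Ω → Ω → Set₁
ClosedNormalGen H x g =
  ∀ (S : Ω → Set) → IsClosedSubgroup S →
  (∀ h y → H h → S y → S (h · y · inv h)) → S x → S g

-- Let V be the closed subgroup generated by γ₁ = a₂a₃⁻¹ and γ₂ = a₃⁻¹a₂. As γ₂ = a₃⁻¹γ₁a₃,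
-- V ⊆ U. Conversely U ⊆ V once V is normal in G, and since the normaliser of a closed set is
-- a closed subgroup it suffices that σ, a₂ and a₃ normalise V. The recursion yields σ² = 1,
-- a₂a₃ = σ and a₂⁴ = a₃⁴ = 1 (the last because a₃⁴ = (1, a₃⁴)); in any group these relations
-- make conjugation by σ, a₃ and a₃⁻¹ send γ₁, γ₂ into {γ₁^±1, γ₂^±1}, and a₂ = σa₃⁻¹.
module Submission where

open import Algebra.Bundles using (Group)
open import Data.Bool using (Bool; true; false; _xor_; if_then_else_)
open import Data.Bool.Properties using (xor-assoc; xor-identityʳ; xor-same)
open import Data.List using (List; []; _∷_; length)
open import Data.List.Membership.Propositional using (_∈_)
open import Data.List.Relation.Unary.All as All using (All; []; _∷_)
open import Data.List.Relation.Unary.Any using (here; there)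
open import Data.Nat using (suc; s≤s; z≤n)
open import Data.Nat.Properties using (n<1+n)
open import Data.Product using (Σ; _×_; _,_; proj₁; proj₂)
open import Function.Bundles using (_⇔_; mk⇔)
open import Level using (0ℓ)
open import Relation.Binary.Bundles using (Setoid)
open import Relation.Binary.Definitions using (_Respects_)
open import Relation.Binary.PropositionalEquality as ≡ using (refl; cong₂; _→-setoid_)

module Conjugation {c ℓ} (G : Group c ℓ) where
  open Group G
  open import Algebra.Properties.Group G
    using (inverseˡ-unique; inverseʳ-unique; ε⁻¹≈ε; ⁻¹-involutive; ⁻¹-anti-homo-∙;
           \\-leftDividesˡ; \\-leftDividesʳ; //-rightDividesʳ)
  open import Relation.Binary.Reasoning.Setoid setoid

  conj : Carrier → Carrier → Carrier
  conj k x = k ∙ x ∙ k ⁻¹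

  conj-homo-ε : ∀ k → conj k ε ≈ ε
  conj-homo-ε k = trans (∙-congʳ (identityʳ k)) (inverseʳ k)

  conj-homo-∙ : ∀ k x y → conj k (x ∙ y) ≈ conj k x ∙ conj k y
  conj-homo-∙ k x y = begin
    k ∙ (x ∙ y) ∙ k ⁻¹               ≈⟨ ∙-congʳ (assoc k x y) ⟨
    k ∙ x ∙ y ∙ k ⁻¹                 ≈⟨ ∙-congʳ (∙-congˡ (\\-leftDividesʳ k y)) ⟨
    k ∙ x ∙ (k ⁻¹ ∙ (k ∙ y)) ∙ k ⁻¹  ≈⟨ ∙-congʳ (assoc (k ∙ x) (k ⁻¹) (k ∙ y)) ⟨
    k ∙ x ∙ k ⁻¹ ∙ (k ∙ y) ∙ k ⁻¹    ≈⟨ assoc (conj k x) (k ∙ y) (k ⁻¹) ⟩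
    conj k x ∙ conj k y              ∎

  conj-homo-⁻¹ : ∀ k x → conj k (x ⁻¹) ≈ conj k x ⁻¹
  conj-homo-⁻¹ k x = begin
    k ∙ x ⁻¹ ∙ k ⁻¹       ≈⟨ assoc k (x ⁻¹) (k ⁻¹) ⟩
    k ∙ (x ⁻¹ ∙ k ⁻¹)     ≈⟨ ∙-cong (⁻¹-involutive k) (⁻¹-anti-homo-∙ k x) ⟨
    k ⁻¹ ⁻¹ ∙ (k ∙ x) ⁻¹  ≈⟨ ⁻¹-anti-homo-∙ (k ∙ x) (k ⁻¹) ⟨
    conj k x ⁻¹           ∎

  conj-by-ε : ∀ x → conj ε x ≈ x
  conj-by-ε x = trans (∙-cong (identityˡ x) ε⁻¹≈ε) (identityʳ x)

  conj-by-∙ : ∀ k l x → conj (k ∙ l) x ≈ conj k (conj l x)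
  conj-by-∙ k l x = begin
    k ∙ l ∙ x ∙ (k ∙ l) ⁻¹       ≈⟨ ∙-cong (assoc k l x) (⁻¹-anti-homo-∙ k l) ⟩
    k ∙ (l ∙ x) ∙ (l ⁻¹ ∙ k ⁻¹)  ≈⟨ assoc (k ∙ (l ∙ x)) (l ⁻¹) (k ⁻¹) ⟨
    k ∙ (l ∙ x) ∙ l ⁻¹ ∙ k ⁻¹    ≈⟨ ∙-congʳ (assoc k (l ∙ x) (l ⁻¹)) ⟩
    conj k (conj l x)            ∎

  conj-involution : ∀ k {x} → x ∙ x ≈ ε → conj k x ∙ conj k x ≈ ε
  conj-involution k {x} x²≈ε = begin
    conj k x ∙ conj k x  ≈⟨ conj-homo-∙ k x x ⟨
    conj k (x ∙ x)       ≈⟨ ∙-congʳ (∙-congˡ x²≈ε) ⟩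
    conj k ε             ≈⟨ conj-homo-ε k ⟩
    ε                    ∎

  module Relations (s a b : Carrier) (s²≈ε : s ∙ s ≈ ε) (ab≈s : a ∙ b ≈ s) where
    s⁻¹≈s : s ⁻¹ ≈ s
    s⁻¹≈s = sym (inverseʳ-unique s s s²≈ε)

    a≈sb⁻¹ : a ≈ s ∙ b ⁻¹
    a≈sb⁻¹ = trans (sym (//-rightDividesʳ b a)) (∙-congʳ ab≈s)

    sa≈b⁻¹ : s ∙ a ≈ b ⁻¹
    sa≈b⁻¹ = trans (∙-cong (sym s⁻¹≈s) a≈sb⁻¹) (\\-leftDividesʳ s (b ⁻¹))

    a⁻¹≈bs : a ⁻¹ ≈ b ∙ s
    a⁻¹≈bs = begin
      a ⁻¹            ≈⟨ ⁻¹-cong a≈sb⁻¹ ⟩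
      (s ∙ b ⁻¹) ⁻¹   ≈⟨ ⁻¹-anti-homo-∙ s (b ⁻¹) ⟩
      b ⁻¹ ⁻¹ ∙ s ⁻¹  ≈⟨ ∙-cong (⁻¹-involutive b) s⁻¹≈s ⟩
      b ∙ s           ∎

    [b⁻¹a⁻¹]²≈ε : b ⁻¹ ∙ a ⁻¹ ∙ (b ⁻¹ ∙ a ⁻¹) ≈ ε
    [b⁻¹a⁻¹]²≈ε = trans (∙-cong b⁻¹a⁻¹≈s b⁻¹a⁻¹≈s) s²≈ε
      where
      b⁻¹a⁻¹≈s : b ⁻¹ ∙ a ⁻¹ ≈ s
      b⁻¹a⁻¹≈s = trans (sym (⁻¹-anti-homo-∙ a b)) (trans (⁻¹-cong ab≈s) s⁻¹≈s)

    [a⁻¹b⁻¹]²≈ε : a ⁻¹ ∙ b ⁻¹ ∙ (a ⁻¹ ∙ b ⁻¹) ≈ ε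
    [a⁻¹b⁻¹]²≈ε = trans (∙-cong a⁻¹b⁻¹≈conj a⁻¹b⁻¹≈conj) (conj-involution b s²≈ε)
      where
      a⁻¹b⁻¹≈conj : a ⁻¹ ∙ b ⁻¹ ≈ conj b s
      a⁻¹b⁻¹≈conj = ∙-congʳ a⁻¹≈bs

    γ₁ γ₂ : Carrier
    γ₁ = a ∙ b ⁻¹
    γ₂ = b ⁻¹ ∙ a

    module Order4 (a⁴≈ε : a ∙ a ∙ (a ∙ a) ≈ ε) (b⁴≈ε : b ∙ b ∙ (b ∙ b) ≈ ε) where
      b²≈b⁻¹b⁻¹ : b ∙ b ≈ b ⁻¹ ∙ b ⁻¹
      b²≈b⁻¹b⁻¹ = trans (inverseˡ-unique (b ∙ b) (b ∙ b) b⁴≈ε) (⁻¹-anti-homo-∙ b b)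

      a³≈a⁻¹ : a ∙ a ∙ a ≈ a ⁻¹
      a³≈a⁻¹ = inverseˡ-unique (a ∙ a ∙ a) a (trans (assoc (a ∙ a) a a) a⁴≈ε)

      γ₁⁻¹≈bbs : γ₁ ⁻¹ ≈ b ∙ b ∙ s
      γ₁⁻¹≈bbs = begin
        (a ∙ b ⁻¹) ⁻¹   ≈⟨ ⁻¹-anti-homo-∙ a (b ⁻¹) ⟩
        b ⁻¹ ⁻¹ ∙ a ⁻¹  ≈⟨ ∙-cong (⁻¹-involutive b) a⁻¹≈bs ⟩
        b ∙ (b ∙ s)     ≈⟨ assoc b b s ⟨
        b ∙ b ∙ s       ∎

      γ₂⁻¹≈bsb : γ₂ ⁻¹ ≈ b ∙ s ∙ b
      γ₂⁻¹≈bsb = begin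
        (b ⁻¹ ∙ a) ⁻¹   ≈⟨ ⁻¹-anti-homo-∙ (b ⁻¹) a ⟩
        a ⁻¹ ∙ b ⁻¹ ⁻¹  ≈⟨ ∙-cong a⁻¹≈bs (⁻¹-involutive b) ⟩
        b ∙ s ∙ b       ∎

      conj-s-γ₁ : conj s γ₁ ≈ γ₁ ⁻¹
      conj-s-γ₁ = begin
        s ∙ (a ∙ b ⁻¹) ∙ s ⁻¹  ≈⟨ ∙-cong (sym (assoc s a (b ⁻¹))) s⁻¹≈s ⟩
        s ∙ a ∙ b ⁻¹ ∙ s       ≈⟨ ∙-congʳ (∙-congʳ sa≈b⁻¹) ⟩
        b ⁻¹ ∙ b ⁻¹ ∙ s        ≈⟨ ∙-congʳ b²≈b⁻¹b⁻¹ ⟨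
        b ∙ b ∙ s              ≈⟨ γ₁⁻¹≈bbs ⟨
        γ₁ ⁻¹                  ∎

      conj-s-γ₂ : conj s γ₂ ≈ γ₂ ⁻¹
      conj-s-γ₂ = begin
        s ∙ (b ⁻¹ ∙ a) ∙ s ⁻¹   ≈⟨ ∙-cong (sym (assoc s (b ⁻¹) a)) (trans s⁻¹≈s (sym ab≈s)) ⟩
        s ∙ b ⁻¹ ∙ a ∙ (a ∙ b)  ≈⟨ ∙-congʳ (∙-congʳ a≈sb⁻¹) ⟨
        a ∙ a ∙ (a ∙ b)         ≈⟨ assoc (a ∙ a) a b ⟨
        a ∙ a ∙ a ∙ b           ≈⟨ ∙-congʳ (trans a³≈a⁻¹ a⁻¹≈bs) ⟩
        b ∙ s ∙ b               ≈⟨ γ₂⁻¹≈bsb ⟨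
        γ₂ ⁻¹                   ∎

      conj-b-γ₁ : conj b γ₁ ≈ γ₂ ⁻¹
      conj-b-γ₁ = begin
        b ∙ (a ∙ b ⁻¹) ∙ b ⁻¹    ≈⟨ assoc b (a ∙ b ⁻¹) (b ⁻¹) ⟩
        b ∙ (a ∙ b ⁻¹ ∙ b ⁻¹)    ≈⟨ ∙-congˡ (assoc a (b ⁻¹) (b ⁻¹)) ⟩
        b ∙ (a ∙ (b ⁻¹ ∙ b ⁻¹))  ≈⟨ ∙-congˡ (∙-congˡ b²≈b⁻¹b⁻¹) ⟨
        b ∙ (a ∙ (b ∙ b))        ≈⟨ ∙-congˡ (assoc a b b) ⟨
        b ∙ (a ∙ b ∙ b)          ≈⟨ ∙-congˡ (∙-congʳ ab≈s) ⟩
        b ∙ (s ∙ b)              ≈⟨ assoc b s b ⟨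
        b ∙ s ∙ b                ≈⟨ γ₂⁻¹≈bsb ⟨
        γ₂ ⁻¹                    ∎

      conj-b-γ₂ : conj b γ₂ ≈ γ₁
      conj-b-γ₂ = ∙-congʳ (\\-leftDividesˡ b a)

      conj-b⁻¹-γ₁ : conj (b ⁻¹) γ₁ ≈ γ₂
      conj-b⁻¹-γ₁ = trans (assoc (b ⁻¹) γ₁ (b ⁻¹ ⁻¹)) (∙-congˡ (//-rightDividesʳ (b ⁻¹) a))

      conj-b⁻¹-γ₂ : conj (b ⁻¹) γ₂ ≈ γ₁ ⁻¹
      conj-b⁻¹-γ₂ = begin
        b ⁻¹ ∙ (b ⁻¹ ∙ a) ∙ b ⁻¹ ⁻¹  ≈⟨ ∙-cong (sym (assoc (b ⁻¹) (b ⁻¹) a)) (⁻¹-involutive b) ⟩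
        b ⁻¹ ∙ b ⁻¹ ∙ a ∙ b          ≈⟨ assoc (b ⁻¹ ∙ b ⁻¹) a b ⟩
        b ⁻¹ ∙ b ⁻¹ ∙ (a ∙ b)        ≈⟨ ∙-cong (sym b²≈b⁻¹b⁻¹) ab≈s ⟩
        b ∙ b ∙ s                    ≈⟨ γ₁⁻¹≈bbs ⟨
        γ₁ ⁻¹                        ∎

open import Defs

sec-agree : ∀ {n g h} → Agree (suc n) g h → ∀ i → Agree n (sec g i) (sec h i)
sec-agree g≈h i w lt = g≈h (i ∷ w) (s≤s lt)

·-agree : ∀ {n g g′ h h′} → Agree n g g′ → Agree n h h′ → Agree n (g · h) (g′ · h′)
·-agree g≈g′ h≈h′ [] lt = cong₂ _xor_ (g≈g′ [] lt) (h≈h′ [] lt)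
·-agree {suc n} {g′ = g′} g≈g′ h≈h′ (i ∷ w) (s≤s lt) rewrite g≈g′ [] (s≤s z≤n) =
  ·-agree (sec-agree g≈g′ i) (sec-agree h≈h′ (i xor g′ [])) w lt

inv-agree : ∀ {n g g′} → Agree n g g′ → Agree n (inv g) (inv g′)
inv-agree g≈g′ [] lt = g≈g′ [] lt
inv-agree {suc n} {g′ = g′} g≈g′ (i ∷ w) (s≤s lt) rewrite g≈g′ [] (s≤s z≤n) =
  inv-agree (sec-agree g≈g′ (i xor g′ [])) w lt

≈⇒agree : ∀ {n g h} → g ≈ h → Agree n g h
≈⇒agree g≈h w _ = g≈h w

agree⇒≈ : ∀ {g h} → (∀ {n} → Agree n g h) → g ≈ h
agree⇒≈ g≈h w = g≈h w (n<1+n (length w))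

·-cong : ∀ {g g′ h h′} → g ≈ g′ → h ≈ h′ → g · h ≈ g′ · h′
·-cong g≈g′ h≈h′ = agree⇒≈ (·-agree (≈⇒agree g≈g′) (≈⇒agree h≈h′))

inv-cong : ∀ {g g′} → g ≈ g′ → inv g ≈ inv g′
inv-cong g≈g′ = agree⇒≈ (inv-agree (≈⇒agree g≈g′))

·-assoc : ∀ g h k → g · h · k ≈ g · (h · k)
·-assoc g h k [] = xor-assoc (g []) (h []) (k [])
·-assoc g h k (i ∷ w) rewrite xor-assoc i (g []) (h []) =
  ·-assoc (sec g i) (sec h (i xor g [])) (sec k (i xor g [] xor h [])) w

·-identityˡ : ∀ g → e · g ≈ g
·-identityˡ g [] = refl
·-identityˡ g (i ∷ w) rewrite xor-identityʳ i = ·-identityˡ (sec g i) w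

·-identityʳ : ∀ g → g · e ≈ g
·-identityʳ g [] = xor-identityʳ (g [])
·-identityʳ g (i ∷ w) = ·-identityʳ (sec g i) w

inv-inverseˡ : ∀ g → inv g · g ≈ e
inv-inverseˡ g [] = xor-same (g [])
inv-inverseˡ g (i ∷ w) = inv-inverseˡ (sec g (i xor g [])) w

inv-inverseʳ : ∀ g → g · inv g ≈ e
inv-inverseʳ g [] = xor-same (g [])
inv-inverseʳ g (i ∷ w) rewrite xor-assoc i (g []) (g []) | xor-same (g []) | xor-identityʳ i =
  inv-inverseʳ (sec g i) w

Ω-group : Group 0ℓ 0ℓ
Ω-group = record
  { Carrier = Ω
  ; _≈_     = _≈_
  ; _∙_     = _·_
  ; ε       = e
  ; _⁻¹     = inv
  ; isGroup = record
    { isMonoid = record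
      { isSemigroup = record
        { isMagma = record
          { isEquivalence = Setoid.isEquivalence (Word →-setoid Bool)
          ; ∙-cong        = ·-cong
          }
        ; assoc = ·-assoc
        }
      ; identity = ·-identityˡ , ·-identityʳ
      }
    ; inverse = inv-inverseˡ , inv-inverseʳ
    ; ⁻¹-cong = inv-cong
    }
  }

open Conjugation Ω-group
open Group Ω-group using (setoid)
  renaming (refl to ≈-refl; sym to ≈-sym; trans to ≈-trans)
open import Algebra.Properties.Group Ω-group using (ε⁻¹≈ε; ⁻¹-involutive; ⁻¹-anti-homo-∙)
open import Relation.Binary.Reasoning.Setoid setoid

node-· : ∀ t x y t′ u v →
  node t x y · node t′ u v ≈ node (t xor t′) (x · (if t then v else u)) (y · (if t then u else v))
node-· t     x y t′ u v []          = refl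
node-· false x y t′ u v (false ∷ w) = refl
node-· false x y t′ u v (true ∷ w)  = refl
node-· true  x y t′ u v (false ∷ w) = refl
node-· true  x y t′ u v (true ∷ w)  = refl

node-cong : ∀ t {x x′ y y′} → x ≈ x′ → y ≈ y′ → node t x y ≈ node t x′ y′
node-cong t x≈x′ y≈y′ []          = refl
node-cong t x≈x′ y≈y′ (false ∷ w) = x≈x′ w
node-cong t x≈x′ y≈y′ (true ∷ w)  = y≈y′ w

node-e : node false e e ≈ e
node-e []          = refl
node-e (false ∷ w) = refl
node-e (true ∷ w)  = refl

node-false-e-fixpoint : ∀ {x} → x ≈ node false e x → x ≈ e
node-false-e-fixpoint x≈node []          = x≈node []
node-false-e-fixpoint x≈node (false ∷ w) = x≈node (false ∷ w)
node-false-e-fixpoint x≈node (true ∷ w)  =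
  ≡.trans (x≈node (true ∷ w)) (node-false-e-fixpoint x≈node w)

σ²≈e : σ · σ ≈ e
σ²≈e = begin
  σ · σ                       ≈⟨ node-· true e e true e e ⟩
  node false (e · e) (e · e)  ≈⟨ node-cong false (·-identityˡ e) (·-identityˡ e) ⟩
  node false e e              ≈⟨ node-e ⟩
  e                           ∎

data Generated (gens : List Ω) : Ω → Set where
  gen     : ∀ {g} → g ∈ gens → Generated gens g
  unit    : Generated gens e
  mul     : ∀ {g h} → Generated gens g → Generated gens h → Generated gens (g · h)
  inverse : ∀ {g} → Generated gens g → Generated gens (inv g)

generated-isSubgroup : ∀ gens → IsSubgroup (Generated gens)
generated-isSubgroup gens = unit , (λ _ _ → mul) , (λ _ → inverse)

generated-minimal : ∀ {gens S} → IsSubgroup S → All S gens → ∀ {g} → Generated gens g → S g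
generated-minimal S-sub             S-gens (gen g∈gens) = All.lookup S-gens g∈gens
generated-minimal (S-e , _ , _)     S-gens unit         = S-e
generated-minimal S-sub@(_ , S-· , _) S-gens (mul p q)  =
  S-· _ _ (generated-minimal S-sub S-gens p) (generated-minimal S-sub S-gens q)
generated-minimal S-sub@(_ , _ , S-inv) S-gens (inverse p) =
  S-inv _ (generated-minimal S-sub S-gens p)

Closure : (Ω → Set) → Ω → Set
Closure P g = ∀ n → Σ Ω λ h → P h × Agree n g h

closure-extensive : ∀ {P g} → P g → Closure P g
closure-extensive Pg n = _ , Pg , ≈⇒agree ≈-refl

closure-isClosed : ∀ P → IsClosed (Closure P)
closure-isClosed P g approx n =
  let (h , closure-h , g≈h) = approx n
      (h′ , Ph′ , h≈h′) = closure-h n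
  in  h′ , Ph′ , λ w lt → ≡.trans (g≈h w lt) (h≈h′ w lt)

closure-isSubgroup : ∀ {P} → IsSubgroup P → IsSubgroup (Closure P)
closure-isSubgroup (P-e , P-· , P-inv) = closure-extensive P-e , closure-· , closure-inv
  where
  closure-· : ∀ g h → Closure _ g → Closure _ h → Closure _ (g · h)
  closure-· g h closure-g closure-h n =
    let (g′ , Pg′ , g≈g′) = closure-g n
        (h′ , Ph′ , h≈h′) = closure-h n
    in  g′ · h′ , P-· _ _ Pg′ Ph′ , ·-agree g≈g′ h≈h′
  closure-inv : ∀ g → Closure _ g → Closure _ (inv g)
  closure-inv g closure-g n =
    let (g′ , Pg′ , g≈g′) = closure-g n in inv g′ , P-inv _ Pg′ , inv-agree g≈g′

closure-minimal : ∀ {P S} → IsClosed S → (∀ {g} → P g → S g) → ∀ {g} → Closure P g → S g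
closure-minimal S-closed P⊆S {g} closure-g =
  S-closed g λ n → let (h , Ph , g≈h) = closure-g n in h , P⊆S Ph , g≈h

isClosed⇒respects-≈ : ∀ {S} → IsClosed S → S Respects _≈_
isClosed⇒respects-≈ S-closed {g} {h} g≈h Sg = S-closed h λ n → g , Sg , ≈⇒agree (≈-sym g≈h)

-- ClosedGen quantifies over all closed subgroups and so lives in Set₁; this Set-valued
-- description of the same subgroup can itself be offered as a test subgroup.
ClosedSpan : List Ω → Ω → Set
ClosedSpan gens = Closure (Generated gens)

closedSpan-isClosedSubgroup : ∀ gens → IsClosedSubgroup (ClosedSpan gens)
closedSpan-isClosedSubgroup gens =
  closure-isSubgroup (generated-isSubgroup gens) , closure-isClosed (Generated gens)

closedSpan⇒closedGen : ∀ {gens g} → ClosedSpan gens g → ClosedGen gens g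
closedSpan⇒closedGen closedSpan-g S (S-sub , S-closed) S-gens =
  closure-minimal S-closed (generated-minimal S-sub S-gens) closedSpan-g

conj-agree : ∀ {n k k′ g g′} → Agree n k k′ → Agree n g g′ → Agree n (conj k g) (conj k′ g′)
conj-agree k≈k′ g≈g′ = ·-agree (·-agree k≈k′ g≈g′) (inv-agree k≈k′)

conj-preimage-isClosedSubgroup :
  ∀ {V} → IsClosedSubgroup V → ∀ k → IsClosedSubgroup (λ g → V (conj k g))
conj-preimage-isClosedSubgroup {V} ((V-e , V-· , V-inv) , V-closed) k =
  ( V-resp (≈-sym (conj-homo-ε k)) V-e
  , (λ g h Vg Vh → V-resp (≈-sym (conj-homo-∙ k g h)) (V-· _ _ Vg Vh))
  , (λ g Vg → V-resp (≈-sym (conj-homo-⁻¹ k g)) (V-inv _ Vg)) )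
  , λ g approx → V-closed (conj k g) λ n →
      let (h , V-conj-h , g≈h) = approx n in conj k h , V-conj-h , conj-agree (≈⇒agree ≈-refl) g≈h
  where
  V-resp : V Respects _≈_
  V-resp = isClosed⇒respects-≈ V-closed

Normalises : (Ω → Set) → Ω → Set
Normalises V k = ∀ {g} → V g → V (conj k g)

Normaliser : (Ω → Set) → Ω → Set
Normaliser V k = Normalises V k × Normalises V (inv k)

normalises-closedSpan :
  ∀ {gens k} → All (λ x → ClosedSpan gens (conj k x)) gens → Normalises (ClosedSpan gens) k
normalises-closedSpan {gens} {k} conj-gens =
  closure-minimal (proj₂ preimage) (generated-minimal (proj₁ preimage) conj-gens)
  where
  preimage : IsClosedSubgroup (λ g → ClosedSpan gens (conj k g))
  preimage = conj-preimage-isClosedSubgroup (closedSpan-isClosedSubgroup gens) k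

module _ {V : Ω → Set} (V-closed : IsClosed V) where
  private
    V-resp : V Respects _≈_
    V-resp = isClosed⇒respects-≈ V-closed

  normalises-resp : Normalises V Respects _≈_
  normalises-resp k≈k′ Nk Vg = V-resp (·-cong (·-cong k≈k′ ≈-refl) (inv-cong k≈k′)) (Nk Vg)

  normalises-e : Normalises V e
  normalises-e {g} Vg = V-resp (≈-sym (conj-by-ε g)) Vg

  normalises-· : ∀ {k l} → Normalises V k → Normalises V l → Normalises V (k · l)
  normalises-· {k} {l} Nk Nl {g} Vg = V-resp (≈-sym (conj-by-∙ k l g)) (Nk (Nl Vg))

  normalises-isClosed : IsClosed (Normalises V)
  normalises-isClosed k approx {g} Vg = V-closed (conj k g) λ n →
    let (h , Nh , k≈h) = approx n in conj h g , Nh Vg , conj-agree k≈h (≈⇒agree ≈-refl)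

  normaliser-isClosedSubgroup : IsClosedSubgroup (Normaliser V)
  normaliser-isClosedSubgroup =
    ( (normalises-e , normalises-resp (≈-sym ε⁻¹≈ε) normalises-e)
    , (λ k l (Nk , Nk⁻¹) (Nl , Nl⁻¹) →
         normalises-· Nk Nl , normalises-resp (≈-sym (⁻¹-anti-homo-∙ k l)) (normalises-· Nl⁻¹ Nk⁻¹))
    , (λ k (Nk , Nk⁻¹) → Nk⁻¹ , normalises-resp (≈-sym (⁻¹-involutive k)) Nk) )
    , λ k approx →
        normalises-isClosed k (λ n → let (h , (Nh , _) , k≈h) = approx n in h , Nh , k≈h)
      , normalises-isClosed (inv k) (λ n →
          let (h , (_ , Nh⁻¹) , k≈h) = approx n in inv h , Nh⁻¹ , inv-agree k≈h)

module Generators (a₂ a₃ : Ω)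
  (a₂-rec : a₂ ≈ node true (inv a₃) (inv a₂)) (a₃-rec : a₃ ≈ node false a₂ a₃) where

  a₂a₃≈σ : a₂ · a₃ ≈ σ
  a₂a₃≈σ = begin
    a₂ · a₃
      ≈⟨ ·-cong a₂-rec a₃-rec ⟩
    node true (inv a₃) (inv a₂) · node false a₂ a₃
      ≈⟨ node-· true _ _ false _ _ ⟩
    node true (inv a₃ · a₃) (inv a₂ · a₂)
      ≈⟨ node-cong true (inv-inverseˡ a₃) (inv-inverseˡ a₂) ⟩
    σ ∎

  open Relations σ a₂ a₃ σ²≈e a₂a₃≈σ public

  a₂⁴≈e : a₂ · a₂ · (a₂ · a₂) ≈ e
  a₂⁴≈e = begin
    a₂ · a₂ · (a₂ · a₂)
      ≈⟨ ≈-trans (·-cong a₂² a₂²) (node-· false _ _ false _ _) ⟩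
    node false (a₃⁻¹a₂⁻¹ · a₃⁻¹a₂⁻¹) (a₂⁻¹a₃⁻¹ · a₂⁻¹a₃⁻¹)
      ≈⟨ node-cong false [b⁻¹a⁻¹]²≈ε [a⁻¹b⁻¹]²≈ε ⟩
    node false e e
      ≈⟨ node-e ⟩
    e ∎
    where
    a₃⁻¹a₂⁻¹ a₂⁻¹a₃⁻¹ : Ω
    a₃⁻¹a₂⁻¹ = inv a₃ · inv a₂
    a₂⁻¹a₃⁻¹ = inv a₂ · inv a₃
    a₂² : a₂ · a₂ ≈ node false a₃⁻¹a₂⁻¹ a₂⁻¹a₃⁻¹
    a₂² = ≈-trans (·-cong a₂-rec a₂-rec) (node-· true _ _ true _ _)

  a₃⁴≈e : a₃ · a₃ · (a₃ · a₃) ≈ e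
  a₃⁴≈e = node-false-e-fixpoint (begin
    a₃ · a₃ · (a₃ · a₃)
      ≈⟨ ≈-trans (·-cong a₃² a₃²) (node-· false _ _ false _ _) ⟩
    node false (a₂ · a₂ · (a₂ · a₂)) (a₃ · a₃ · (a₃ · a₃))
      ≈⟨ node-cong false a₂⁴≈e ≈-refl ⟩
    node false e (a₃ · a₃ · (a₃ · a₃)) ∎)
    where
    a₃² : a₃ · a₃ ≈ node false (a₂ · a₂) (a₃ · a₃)
    a₃² = ≈-trans (·-cong a₃-rec a₃-rec) (node-· false _ _ false _ _)

  open Order4 a₂⁴≈e a₃⁴≈e public

  Γ : List Ω
  Γ = γ₁ ∷ γ₂ ∷ []

  V : Ω → Set
  V = ClosedSpan Γ

  γ₁∈V : V γ₁
  γ₁∈V = closure-extensive (gen (here refl))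

  private
    γ₂∈V : V γ₂
    γ₂∈V = closure-extensive (gen (there (here refl)))

    γ₁⁻¹∈V : V (inv γ₁)
    γ₁⁻¹∈V = closure-extensive (inverse (gen (here refl)))

    γ₂⁻¹∈V : V (inv γ₂)
    γ₂⁻¹∈V = closure-extensive (inverse (gen (there (here refl))))

    V-closed : IsClosed V
    V-closed = closure-isClosed (Generated Γ)

    V-resp : V Respects _≈_
    V-resp = isClosed⇒respects-≈ V-closed

    normalises-Γ : ∀ {k x y} → conj k γ₁ ≈ x → conj k γ₂ ≈ y → V x → V y → Normalises V k
    normalises-Γ k-γ₁ k-γ₂ Vx Vy =
      normalises-closedSpan (V-resp (≈-sym k-γ₁) Vx ∷ V-resp (≈-sym k-γ₂) Vy ∷ [])

  normaliser-V-isClosedSubgroup : IsClosedSubgroup (Normaliser V)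
  normaliser-V-isClosedSubgroup = normaliser-isClosedSubgroup V-closed

  σ∈normaliser : Normaliser V σ
  σ∈normaliser = σ-normalises , normalises-resp V-closed (≈-sym s⁻¹≈s) σ-normalises
    where
    σ-normalises : Normalises V σ
    σ-normalises = normalises-Γ conj-s-γ₁ conj-s-γ₂ γ₁⁻¹∈V γ₂⁻¹∈V

  a₃∈normaliser : Normaliser V a₃
  a₃∈normaliser = normalises-Γ conj-b-γ₁ conj-b-γ₂ γ₂⁻¹∈V γ₁∈V
                , normalises-Γ conj-b⁻¹-γ₁ conj-b⁻¹-γ₂ γ₂∈V γ₁⁻¹∈V

  a₂∈normaliser : Normaliser V a₂
  a₂∈normaliser =
    let ((_ , N-· , N-inv) , N-closed) = normaliser-V-isClosedSubgroup
    in  isClosed⇒respects-≈ N-closed (≈-sym a≈sb⁻¹)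
          (N-· σ (inv a₃) σ∈normaliser (N-inv a₃ a₃∈normaliser))

lemma3p6 : (a₂ a₃ : Ω) →
    a₂ ≈ node true (inv a₃) (inv a₂) →
    a₃ ≈ node false a₂ a₃ →
    ∀ g →
      ClosedNormalGen (ClosedGen (σ ∷ a₂ ∷ a₃ ∷ [])) (a₂ · inv a₃) g
        ⇔ ClosedGen ((a₂ · inv a₃) ∷ (inv a₃ · a₂) ∷ []) g
lemma3p6 a₂ a₃ a₂-rec a₃-rec g = mk⇔ to from
  where
  open Generators a₂ a₃ a₂-rec a₃-rec
  H : Ω → Set₁
  H = ClosedGen (σ ∷ a₂ ∷ a₃ ∷ [])

  H-normalises-V : ∀ h y → H h → V y → V (h · y · inv h)
  H-normalises-V h y Hh = proj₁ (Hh (Normaliser V) normaliser-V-isClosedSubgroup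
                                    (σ∈normaliser ∷ a₂∈normaliser ∷ a₃∈normaliser ∷ []))

  a₃⁻¹∈H : H (inv a₃)
  a₃⁻¹∈H S ((_ , _ , S-inv) , _) (_ ∷ _ ∷ S-a₃ ∷ []) = S-inv a₃ S-a₃

  to : ClosedNormalGen H (a₂ · inv a₃) g → ClosedGen Γ g
  to U-g = closedSpan⇒closedGen (U-g V (closedSpan-isClosedSubgroup Γ) H-normalises-V γ₁∈V)

  from : ClosedGen Γ g → ClosedNormalGen H (a₂ · inv a₃) g
  from Γ-g S S-closedSubgroup S-normal S-γ₁ = Γ-g S S-closedSubgroup (S-γ₁ ∷ S-γ₂ ∷ [])
    where
    S-γ₂ : S γ₂
    S-γ₂ = isClosed⇒respects-≈ (proj₂ S-closedSubgroup) conj-b⁻¹-γ₁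
             (S-normal (inv a₃) γ₁ a₃⁻¹∈H S-γ₁)
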